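{- Let $G$ be a finite graph and $S,R$ roots of $G$ with $S=R$ in the graph monoid $\mathcal{M}(G)$. Then there exist a basis $B_S$ of a cofinite inescapable subspace of $\mathcal{T}(G,S)$, a basis $B_R$ of a cofinite inescapable subspace of $\mathcal{T}(G,R)$, and a bijection $\pi:B_S\to B_R$ such that $T(p)=T(\pi(p))$ for all $p\in B_S$.
   Context: A graph is $G=(V,E,o,t)$ with vertex set $V$, edge set $E$, maps $o,t:E\to V$ (origin, terminus); loops and multiple edges allowed. $E_o(v)=\{e:o(e)=v\}$. A walk is an empty walk $\epsilon_v$ ($O=T=v$) or $e_1\dots e_n$ with $t(e_i)=o(e_{i+1})$, $O=o(e_1)$, $T=t(e_n)$. A root is a vertex from which every vertex is reachable. The unfolding tree $\mathcal{T}(G,S)$ has vertex set $\mathcal{W}(G,S)$ of walks with origin $S$, and an edge from $w$ to $we$ whenever $e$ is an edge and $we$ a walk. Write $w\le_p w'$ if $w'=wu$ for some walk $u$. A vertex-induced subgraph $\mathcal{S}$ of $\mathcal{T}(G,S)$ is a subspace if $w\in\mathcal{S}$, $w\le_p w'$ imply $w'\in\mathcal{S}$; inescapable if each $w\in\mathcal{W}(G,S)$ has some $w'\in\mathcal{S}$ with $w\le_p w'$; cofinite if there is a finite $F$ with $V\mathcal{S}=\{w:\exists x\in F,\ x\le_p w\}$. The basis of a subspace is the set of its $\le_p$-minimal elements. The graph monoid $\mathcal{M}(G)$ is the commutative monoid generated by $V$ subject to $v=\sum_{e\in E_o(v)}t(e)$ for each $v$ with $E_o(v)\ne\emptyset$.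 -}

module Defs where

open import Data.Nat using (ℕ; _+_; _*_)
open import Data.Fin using (Fin; _≟_)
open import Data.List using (List; map; allFin)
open import Data.Nat.ListAction using (sum)
open import Data.List.Membership.Propositional using (_∈_)
open import Data.Product using (Σ; ∃; ∃-syntax; _×_; _,_; proj₁)
open import Relation.Binary.PropositionalEquality using (_≡_)
open import Relation.Nullary using (¬_; yes; no)
open import Function using (_⇔_)

record Graph : Set where
  field
    nV : ℕ
    nE : ℕ
    o  : Fin nE → Fin nV
    t  : Fin nE → Fin nV
open Graph public

module _ (G : Graph) where

  data Walk : Fin (nV G) → Fin (nV G) → Set where
    ε    : (v : Fin (nV G)) → Walk v v
    step : (e : Fin (nE G)) {w : Fin (nV G)} → Walk (t G e) w → Walk (o G e) w

  _++_ : ∀ {a b c} → Walk a b → Walk b c → Walk a c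
  ε _ ++ u = u
  step e w ++ u = step e (w ++ u)

  -- Vertices of the unfolding tree T(G,S): walks with origin S (with their terminus).
  Walks : Fin (nV G) → Set
  Walks S = Σ (Fin (nV G)) (Walk S)

  T : ∀ {S} → Walks S → Fin (nV G)
  T = proj₁

  _≤p_ : ∀ {S} → Walks S → Walks S → Set
  (a , w) ≤p (b , w') = Σ (Walk a b) λ u → w ++ u ≡ w'

  IsRoot : Fin (nV G) → Set
  IsRoot S = ∀ v → Walk S v

  -- Vertex-induced subgraphs of T(G,S) are identified with their vertex sets,
  -- given as predicates on walks with origin S.
  IsSubspace : ∀ {S} → (Walks S → Set) → Set
  IsSubspace P = ∀ w w' → P w → w ≤p w' → P w'

  IsInescapable : ∀ {S} → (Walks S → Set) → Set
  IsInescapable {S} P = ∀ (w : Walks S) → ∃[ w' ] (w ≤p w' × P w')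

  IsCofinite : ∀ {S} → (Walks S → Set) → Set
  IsCofinite {S} P = ∃[ F ] (∀ (w : Walks S) → P w ⇔ (∃[ x ] (x ∈ F × x ≤p w)))

  InBasis : ∀ {S} → (Walks S → Set) → Walks S → Set
  InBasis P w = P w × (∀ w' → P w' → w' ≤p w → w' ≡ w)

  -- Graph monoid M(G): free commutative monoid on V (vectors V → ℕ)
  -- modulo the congruence generated by v = Σ_{e ∈ E_o(v)} t(e).
  Elt : Set
  Elt = Fin (nV G) → ℕ

  δ : Fin (nV G) → Elt
  δ v u with v ≟ u
  ... | yes _ = 1
  ... | no _  = 0

  -- Σ_{e ∈ E_o(v)} t(e) as a vector
  succs : Fin (nV G) → Elt
  succs v u = sum (map (λ e → δ v (o G e) * δ (t G e) u) (allFin (nE G)))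

  data Step : Elt → Elt → Set where
    step : (z : Elt) (v : Fin (nV G)) (e : Fin (nE G)) → o G e ≡ v →
           Step (λ i → z i + δ v i) (λ i → z i + succs v i)

  data _∼_ : Elt → Elt → Set where
    pw  : ∀ {x y} → (∀ i → x i ≡ y i) → x ∼ y
    fwd : ∀ {x y} → Step x y → x ∼ y
    bwd : ∀ {x y} → Step y x → x ∼ y
    tr  : ∀ {x y z} → x ∼ y → y ∼ z → x ∼ z

  EqInMonoid : Fin (nV G) → Fin (nV G) → Set
  EqInMonoid S R = δ S ∼ δ R

{-# OPTIONS --safe #-}
-- Oriented left to right, the relations v = Σ_{e ∈ E_o(v)} t(e) form a confluent rewriting
-- system on ℕ^V: firings at distinct vertices commute and firings at the same vertex agree.
-- So S = R in M(G) gives a common reduct z of S and R. Firing v corresponds to replacing a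
-- basis walk with terminus v by its one-edge extensions, so starting from the empty walk each
-- reduction to z yields a finite maximal antichain of the unfolding tree whose multiset of
-- termini is z. The up-closure of such an antichain is a cofinite inescapable subspace with
-- that antichain as basis, and equal multisets of termini give the bijection.
module Submission where

open import Defs hiding (_++_)
import Defs
open import Algebra.Properties.CommutativeSemigroup using (xy∙z≈xz∙y; x∙yz≈y∙xz)
open import Data.Empty using (⊥-elim)
open import Data.Nat using (ℕ; _+_; _*_; _∸_; _≤_; z≤n; s≤s)
open import Data.Nat.Properties
  using (+-comm; +-assoc; +-identityʳ; *-identityˡ; +-cancelˡ-≡; +-cancelʳ-≡; m∸n+n≡m; m≤n+m;
         +-commutativeSemigroup; module ≤-Reasoning)
open import Data.Nat.ListAction using (sum)
open import Data.Fin using (Fin; _≟_)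
open import Axiom.UniquenessOfIdentityProofs using (module Decidable⇒UIP)
open import Data.List using (List; []; _∷_; [_]; _++_; _∷ʳ_; map; allFin)
open import Data.List.Properties
  using (++-monoid; ∷-injective; ∷ʳ-injective; ++-identityʳ; ++-identityʳ-unique; ++-assoc;
         ++-cancelˡ; ++-conicalˡ; ≡-dec)
open import Data.Product using (Σ; ∃; ∃-syntax; _×_; _,_; proj₁; proj₂)
open import Data.Sum as Sum using (_⊎_; inj₁; inj₂)
open import Data.List.Membership.Propositional using (_∈_; _∉_)
open import Data.List.Relation.Unary.Any using (here; there)
import Data.List.Relation.Unary.All as All
open import Data.List.Relation.Unary.All.Properties using (All¬⇒¬Any)
open import Data.List.Relation.Unary.AllPairs using ([]; _∷_)
open import Data.List.Relation.Unary.Unique.Propositional using (Unique)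
import Data.List.Relation.Unary.Unique.Propositional.Properties as Unique
open import Data.List.Membership.Propositional.Properties
  using (∈-map⁺; ∈-map⁻; ∈-allFin; ∈-++⁺ˡ; ∈-++⁺ʳ; ∈-++⁻)
open import Relation.Binary.PropositionalEquality
  using (_≡_; _≢_; refl; sym; trans; cong; cong₂; subst; subst₂; _≗_; _→-setoid_;
         module ≡-Reasoning)
open import Function using (_∘_; id)
open import Function.Bundles using (mk⇔)
open import Relation.Nullary using (¬_; yes; no)
open import Relation.Binary.Definitions using (DecidableEquality)
import Relation.Binary.Reasoning.Setoid
open import Relation.Binary.Bundles using (Setoid)

module ListPrefix {A : Set} where
  -- A prefix of a list is a left divisor in the free monoid.
  open import Algebra.Properties.Monoid.Divisibility (++-monoid A) public
    using (_∣ˡ_; _,_; ∣ˡ-refl; ∣ˡ-trans)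

  ∣ˡ-antisym : ∀ {xs ys : List A} → xs ∣ˡ ys → ys ∣ˡ xs → xs ≡ ys
  ∣ˡ-antisym {xs} (r , refl) (r′ , eq) = begin
      xs            ≡⟨ sym (++-identityʳ xs) ⟩
      xs ++ []      ≡⟨ cong (xs ++_) (sym (++-conicalˡ r r′ r++r′≡[])) ⟩
      xs ++ r       ∎
    where
    open ≡-Reasoning
    r++r′≡[] : r ++ r′ ≡ []
    r++r′≡[] = ++-identityʳ-unique xs (sym (trans (sym (++-assoc xs r r′)) eq))

  ∣ˡ-∷ʳ⁻ : ∀ {xs ys : List A} {y} → xs ∣ˡ ys ∷ʳ y → xs ∣ˡ ys ⊎ xs ≡ ys ∷ʳ y
  ∣ˡ-∷ʳ⁻ {[]}     {ys}     _ = inj₁ (ys , refl)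
  ∣ˡ-∷ʳ⁻ {x ∷ xs} {[]}     (r , eq) with refl , xs++r≡[] ← ∷-injective eq
    rewrite ++-conicalˡ xs r xs++r≡[] = inj₂ refl
  ∣ˡ-∷ʳ⁻ {x ∷ xs} {y ∷ ys} (r , eq) with refl , eq′ ← ∷-injective eq
    with ∣ˡ-∷ʳ⁻ {xs} {ys} (r , eq′)
  ... | inj₁ (r′ , eq″) = inj₁ (r′ , cong (x ∷_) eq″)
  ... | inj₂ xs≡       = inj₂ (cong (x ∷_) xs≡)

  ∷ʳ-∣ˡ-∷ʳ : ∀ (xs : List A) {x y} → xs ∷ʳ x ∣ˡ xs ∷ʳ y → x ≡ y
  ∷ʳ-∣ˡ-∷ʳ xs {x} (r , eq) =
    proj₁ (∷-injective (++-cancelˡ xs (x ∷ r) [ _ ] (trans (sym (++-assoc xs [ x ] r)) eq)))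

module WalkOrder (G : Graph) where
  open ListPrefix

  V E : Set
  V = Fin (nV G)
  E = Fin (nE G)

  infixr 5 _++ʷ_
  _++ʷ_ : ∀ {a b c} → Walk G a b → Walk G b c → Walk G a c
  _++ʷ_ = Defs._++_ G

  infix 4 _≼_
  _≼_ : ∀ {S} → Walks G S → Walks G S → Set
  _≼_ = _≤p_ G

  edges : ∀ {a b} → Walk G a b → List E
  edges (ε _)      = []
  edges (step e w) = e ∷ edges w

  edges-++ʷ : ∀ {a b c} (w : Walk G a b) (u : Walk G b c) → edges (w ++ʷ u) ≡ edges w ++ edges u
  edges-++ʷ (ε _)      u = refl
  edges-++ʷ (step e w) u = cong (e ∷_) (edges-++ʷ w u)

  ++ʷ-identityʳ : ∀ {a b} (w : Walk G a b) → w ++ʷ ε b ≡ w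
  ++ʷ-identityʳ (ε _)      = refl
  ++ʷ-identityʳ (step e w) = cong (step e) (++ʷ-identityʳ w)

  ++ʷ-assoc : ∀ {a b c d} (w : Walk G a b) (u : Walk G b c) (u′ : Walk G c d) →
              (w ++ʷ u) ++ʷ u′ ≡ w ++ʷ (u ++ʷ u′)
  ++ʷ-assoc (ε _)      u u′ = refl
  ++ʷ-assoc (step e w) u u′ = cong (step e) (++ʷ-assoc w u u′)

  ≼⇒∣ˡ : ∀ {S} {p q : Walks G S} → p ≼ q → edges (proj₂ p) ∣ˡ edges (proj₂ q)
  ≼⇒∣ˡ {p = _ , w} (u , refl) = edges u , sym (edges-++ʷ w u)

  ∣ˡ⇒≼ : ∀ {S a b} (w : Walk G S a) (w′ : Walk G S b) → edges w ∣ˡ edges w′ → (a , w) ≼ (b , w′)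
  ∣ˡ⇒≼ (ε _)      w′ _ = w′ , refl
  ∣ˡ⇒≼ {b = b} (step e w) w′ = peel w′ refl
    where
    -- The origin of w′ is generalised so that w′ can be split; K then pins it back.
    peel : ∀ {s} (w′ : Walk G s b) (o≡s : o G e ≡ s) → (e ∷ edges w) ∣ˡ edges w′ →
           Σ (Walk G _ b) λ u → subst (λ s → Walk G s b) o≡s (step e (w ++ʷ u)) ≡ w′
    peel (ε _)         _    (_ , ())
    peel (step e′ w′) o≡s (r , eq) with refl , eq′ ← ∷-injective eq | refl ← o≡s
      with u , refl ← ∣ˡ⇒≼ w w′ (r , eq′) = u , refl

  edges-injective : ∀ {S} {p q : Walks G S} → edges (proj₂ p) ≡ edges (proj₂ q) → p ≡ q
  edges-injective {p = a , w} {q = _ , w′} eq with ∣ˡ⇒≼ w w′ ([] , trans (++-identityʳ _) eq)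
  ... | ε _      , refl = cong (a ,_) (sym (++ʷ-identityʳ w))
  ... | step e u , refl with () ← ++-identityʳ-unique (edges w) (trans eq (edges-++ʷ w (step e u)))

  ≼-refl : ∀ {S} (p : Walks G S) → p ≼ p
  ≼-refl (_ , w) = ∣ˡ⇒≼ w w ∣ˡ-refl

  ≼-trans : ∀ {S} {p q r : Walks G S} → p ≼ q → q ≼ r → p ≼ r
  ≼-trans {p = _ , w} {r = _ , w″} p≼q q≼r = ∣ˡ⇒≼ w w″ (∣ˡ-trans (≼⇒∣ˡ p≼q) (≼⇒∣ˡ q≼r))

  ≼-antisym : ∀ {S} {p q : Walks G S} → p ≼ q → q ≼ p → p ≡ q
  ≼-antisym p≼q q≼p = edges-injective (∣ˡ-antisym (≼⇒∣ˡ p≼q) (≼⇒∣ˡ q≼p))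

  _≟ʷ_ : ∀ {S} → DecidableEquality (Walks G S)
  p ≟ʷ q with ≡-dec _≟_ (edges (proj₂ p)) (edges (proj₂ q))
  ... | yes eq = yes (edges-injective eq)
  ... | no neq = no λ { refl → neq refl }

  Out : V → Set
  Out v = Σ E λ e → o G e ≡ v

  Out-≡ : ∀ {v} {e e′ : Out v} → proj₁ e ≡ proj₁ e′ → e ≡ e′
  Out-≡ {e = e , p} {.e , q} refl = cong (e ,_) (Decidable⇒UIP.≡-irrelevant _≟_ p q)

  edgeWalk : ∀ {v} (e : Out v) → Walk G v (t G (proj₁ e))
  edgeWalk (e , refl) = step e (ε (t G e))

  infixl 6 _▹_
  _▹_ : ∀ {S} (p : Walks G S) → Out (T G p) → Walks G S
  p ▹ e = t G (proj₁ e) , proj₂ p ++ʷ edgeWalk e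

  edges-▹ : ∀ {S} (p : Walks G S) e → edges (proj₂ (p ▹ e)) ≡ edges (proj₂ p) ∷ʳ proj₁ e
  edges-▹ (_ , w) (e , refl) = edges-++ʷ w (step e (ε _))

  ≼-▹ : ∀ {S} (p : Walks G S) e → p ≼ p ▹ e
  ≼-▹ p e = edgeWalk e , refl

  ▹-≢ : ∀ {S} (p : Walks G S) e → p ▹ e ≢ p
  ▹-≢ p e eq with () ← ++-identityʳ-unique (edges (proj₂ p))
                          (sym (trans (sym (edges-▹ p e)) (cong (edges ∘ proj₂) eq)))

  ▹-injective : ∀ {S} (p : Walks G S) {e e′} → p ▹ e ≡ p ▹ e′ → e ≡ e′
  ▹-injective p {e} {e′} eq = Out-≡ (proj₂ (∷ʳ-injective _ _ (begin
    edges (proj₂ p) ∷ʳ proj₁ e    ≡⟨ edges-▹ p e ⟨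
    edges (proj₂ (p ▹ e))         ≡⟨ cong (edges ∘ proj₂) eq ⟩
    edges (proj₂ (p ▹ e′))        ≡⟨ edges-▹ p e′ ⟩
    edges (proj₂ p) ∷ʳ proj₁ e′   ∎)))
    where open ≡-Reasoning

  ▹-≼-▹ : ∀ {S} (p : Walks G S) {e e′} → p ▹ e ≼ p ▹ e′ → p ▹ e ≡ p ▹ e′
  ▹-≼-▹ p {e} {e′} h = cong (p ▹_) (Out-≡ (∷ʳ-∣ˡ-∷ʳ (edges (proj₂ p))
    (subst₂ _∣ˡ_ (edges-▹ p e) (edges-▹ p e′) (≼⇒∣ˡ h))))

  ≼-▹⁻ : ∀ {S} {q : Walks G S} p e → q ≼ p ▹ e → q ≼ p ⊎ q ≡ p ▹ e
  ≼-▹⁻ {q = _ , w} p e h with ∣ˡ-∷ʳ⁻ (subst (_ ∣ˡ_) (edges-▹ p e) (≼⇒∣ˡ h))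
  ... | inj₁ q∣p = inj₁ (∣ˡ⇒≼ w (proj₂ p) q∣p)
  ... | inj₂ eq  = inj₂ (edges-injective (trans eq (sym (edges-▹ p e))))

  ▹⁻-≼ : ∀ {S} (p q : Walks G S) → p ≼ q → q ≡ p ⊎ ∃[ e ] (p ▹ e ≼ q)
  ▹⁻-≼ (_ , w) (_ , _) (ε _ , refl) = inj₁ (cong (_ ,_) (++ʷ-identityʳ w))
  ▹⁻-≼ (_ , w) (_ , _) (step e u , refl) =
    inj₂ ((e , refl) , u , ++ʷ-assoc w (step e (ε _)) u)

module Reduction (G : Graph) where
  open WalkOrder G using (V; E; Out)
  module ≗-Reasoning = Relation.Binary.Reasoning.Setoid (V →-setoid ℕ)
  open Setoid (V →-setoid ℕ) public using ()
    renaming (refl to ≗-refl; sym to ≗-sym; trans to ≗-trans)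

  infixl 6 _⊕_
  _⊕_ : Elt G → Elt G → Elt G
  (x ⊕ y) i = x i + y i

  ⊕-congʳ : ∀ {x y} z → x ≗ y → x ⊕ z ≗ y ⊕ z
  ⊕-congʳ z x≗y i = cong (_+ z i) (x≗y i)

  ⊕-congˡ : ∀ {x y} z → x ≗ y → z ⊕ x ≗ z ⊕ y
  ⊕-congˡ z x≗y i = cong (z i +_) (x≗y i)

  ⊕-comm : ∀ x y → x ⊕ y ≗ y ⊕ x
  ⊕-comm x y i = +-comm (x i) (y i)

  ⊕-cancelʳ : ∀ {x y} z → x ⊕ z ≗ y ⊕ z → x ≗ y
  ⊕-cancelʳ z eq i = +-cancelʳ-≡ (z i) _ _ (eq i)

  ⊕-rightComm : ∀ x y z → x ⊕ y ⊕ z ≗ x ⊕ z ⊕ y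
  ⊕-rightComm x y z i = xy∙z≈xz∙y +-commutativeSemigroup (x i) (y i) (z i)

  δ-diag : ∀ v → δ G v v ≡ 1
  δ-diag v with v ≟ v
  ... | yes _  = refl
  ... | no v≢v = ⊥-elim (v≢v refl)

  δ-off : ∀ {v u} → v ≢ u → δ G v u ≡ 0
  δ-off {v} {u} v≢u with v ≟ u
  ... | yes v≡u = ⊥-elim (v≢u v≡u)
  ... | no _    = refl

  split-δ : ∀ {z₁ z₂ v₁ v₂} → z₁ ⊕ δ G v₁ ≗ z₂ ⊕ δ G v₂ → v₁ ≢ v₂ →
            ∃[ w ] (z₁ ≗ w ⊕ δ G v₂ × z₂ ≗ w ⊕ δ G v₁)
  split-δ {z₁} {z₂} {v₁} {v₂} eq v₁≢v₂ = w , z₁≗ , z₂≗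
    where
    w : Elt G
    w i = z₁ i ∸ δ G v₂ i
    1≤z₁v₂ : 1 ≤ z₁ v₂
    1≤z₁v₂ = begin
      1                  ≤⟨ m≤n+m 1 (z₂ v₂) ⟩
      z₂ v₂ + 1          ≡⟨ cong (z₂ v₂ +_) (δ-diag v₂) ⟨
      z₂ v₂ + δ G v₂ v₂  ≡⟨ eq v₂ ⟨
      z₁ v₂ + δ G v₁ v₂  ≡⟨ cong (z₁ v₂ +_) (δ-off v₁≢v₂) ⟩
      z₁ v₂ + 0          ≡⟨ +-identityʳ (z₁ v₂) ⟩
      z₁ v₂              ∎
      where open ≤-Reasoning
    δ≤z₁ : ∀ i → δ G v₂ i ≤ z₁ i
    δ≤z₁ i with v₂ ≟ i
    ... | no _     = z≤n
    ... | yes refl = 1≤z₁v₂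
    z₁≗ : z₁ ≗ w ⊕ δ G v₂
    z₁≗ i = sym (m∸n+n≡m (δ≤z₁ i))
    z₂≗ : z₂ ≗ w ⊕ δ G v₁
    z₂≗ = ⊕-cancelʳ (δ G v₂) (begin
      z₂ ⊕ δ G v₂           ≈⟨ eq ⟨
      z₁ ⊕ δ G v₁           ≈⟨ ⊕-congʳ (δ G v₁) z₁≗ ⟩
      w ⊕ δ G v₂ ⊕ δ G v₁   ≈⟨ ⊕-rightComm w (δ G v₂) (δ G v₁) ⟩
      w ⊕ δ G v₁ ⊕ δ G v₂   ∎)
      where open ≗-Reasoning

  infix 4 _⟶_ _⟶⁼_ _⟶*_
  data _⟶_ (x y : Elt G) : Set where
    fire : (z : Elt G) (v : V) → Out v → x ≗ z ⊕ δ G v → y ≗ z ⊕ succs G v → x ⟶ y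

  _⟶⁼_ : Elt G → Elt G → Set
  x ⟶⁼ y = x ≗ y ⊎ x ⟶ y

  infixr 5 _◅_
  data _⟶*_ : Elt G → Elt G → Set where
    done : ∀ {x y} → x ≗ y → x ⟶* y
    _◅_ : ∀ {x y z} → x ⟶ y → y ⟶* z → x ⟶* z

  ⟶-respˡ : ∀ {x x′ y} → x′ ≗ x → x ⟶ y → x′ ⟶ y
  ⟶-respˡ x′≗x (fire z v e x≗ y≗) = fire z v e (≗-trans x′≗x x≗) y≗

  ⟶*-respˡ : ∀ {x x′ y} → x′ ≗ x → x ⟶* y → x′ ⟶* y
  ⟶*-respˡ x′≗x (done x≗y)  = done (≗-trans x′≗x x≗y)
  ⟶*-respˡ x′≗x (s ◅ ss) = ⟶-respˡ x′≗x s ◅ ss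

  infixr 5 _◅◅_
  _◅◅_ : ∀ {x y z} → x ⟶* y → y ⟶* z → x ⟶* z
  done x≗y    ◅◅ ss′ = ⟶*-respˡ x≗y ss′
  (s ◅ ss) ◅◅ ss′ = s ◅ (ss ◅◅ ss′)

  ⟶⇒⟶* : ∀ {x y} → x ⟶ y → x ⟶* y
  ⟶⇒⟶* s = s ◅ done ≗-refl

  ⟶⁼⇒⟶* : ∀ {x y} → x ⟶⁼ y → x ⟶* y
  ⟶⁼⇒⟶* (inj₁ x≗y) = done x≗y
  ⟶⁼⇒⟶* (inj₂ s)   = ⟶⇒⟶* s

  ⟶-diamond : ∀ {x y₁ y₂} → x ⟶ y₁ → x ⟶ y₂ → ∃[ w ] (y₁ ⟶⁼ w × y₂ ⟶⁼ w)
  ⟶-diamond {y₁ = y₁} (fire z₁ v₁ e₁ x≗₁ y≗₁) (fire z₂ v₂ e₂ x≗₂ y≗₂) with v₁ ≟ v₂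
  ... | yes refl = y₁ , inj₁ ≗-refl , inj₁ (begin
        _                  ≈⟨ y≗₂ ⟩
        z₂ ⊕ succs G v₁    ≈⟨ ⊕-congʳ (succs G v₁) z₂≗z₁ ⟩
        z₁ ⊕ succs G v₁    ≈⟨ y≗₁ ⟨
        y₁                 ∎)
    where
    open ≗-Reasoning
    z₂≗z₁ : z₂ ≗ z₁
    z₂≗z₁ = ⊕-cancelʳ (δ G v₁) (≗-trans (≗-sym x≗₂) x≗₁)
  ... | no v₁≢v₂ = w ⊕ succs G v₁ ⊕ succs G v₂ , inj₂ (fire _ v₂ e₂ y₁≗ ≗-refl)
                                                , inj₂ (fire _ v₁ e₁ y₂≗ (⊕-rightComm w _ _))
    where
    open ≗-Reasoning
    split = split-δ (≗-trans (≗-sym x≗₁) x≗₂) v₁≢v₂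
    w = proj₁ split
    y₁≗ : y₁ ≗ w ⊕ succs G v₁ ⊕ δ G v₂
    y₁≗ = begin
      y₁                         ≈⟨ y≗₁ ⟩
      z₁ ⊕ succs G v₁            ≈⟨ ⊕-congʳ (succs G v₁) (proj₁ (proj₂ split)) ⟩
      w ⊕ δ G v₂ ⊕ succs G v₁    ≈⟨ ⊕-rightComm w _ _ ⟩
      w ⊕ succs G v₁ ⊕ δ G v₂    ∎
    y₂≗ : _ ≗ w ⊕ succs G v₂ ⊕ δ G v₁
    y₂≗ = begin
      _                          ≈⟨ y≗₂ ⟩
      z₂ ⊕ succs G v₂            ≈⟨ ⊕-congʳ (succs G v₂) (proj₂ (proj₂ split)) ⟩
      w ⊕ δ G v₁ ⊕ succs G v₂    ≈⟨ ⊕-rightComm w _ _ ⟩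
      w ⊕ succs G v₂ ⊕ δ G v₁    ∎

  Joinable : Elt G → Elt G → Set
  Joinable x y = ∃[ w ] (x ⟶* w × y ⟶* w)

  strip : ∀ {x y z} → x ⟶ y → x ⟶* z → Joinable y z
  strip {y = y} s (done x≗z) = y , done ≗-refl , ⟶⇒⟶* (⟶-respˡ (≗-sym x≗z) s)
  strip s (s′ ◅ ss) with ⟶-diamond s s′
  ... | _ , y⟶⁼w , inj₁ y′≗w =
        _ , ⟶⁼⇒⟶* y⟶⁼w ◅◅ ⟶*-respˡ (≗-sym y′≗w) ss , done ≗-refl
  ... | w , y⟶⁼w , inj₂ y′⟶w with strip y′⟶w ss
  ...   | w′ , w⟶*w′ , z⟶*w′ = w′ , ⟶⁼⇒⟶* y⟶⁼w ◅◅ w⟶*w′ , z⟶*w′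

  ⟶*-confluent : ∀ {x y z} → x ⟶* y → x ⟶* z → Joinable y z
  ⟶*-confluent {z = z} (done x≗y) ss = z , ⟶*-respˡ (≗-sym x≗y) ss , done ≗-refl
  ⟶*-confluent (s ◅ ss) ss′ with strip s ss′
  ... | w , y⟶*w , z⟶*w with ⟶*-confluent ss y⟶*w
  ...   | w′ , a , b = w′ , a , z⟶*w ◅◅ b

  ∼⇒Joinable : ∀ {x y} → _∼_ G x y → Joinable x y
  ∼⇒Joinable {y = y} (pw x≗y) = y , done x≗y , done ≗-refl
  ∼⇒Joinable {y = y} (fwd (step z v e refl)) =
    y , ⟶⇒⟶* (fire z v (e , refl) ≗-refl ≗-refl) , done ≗-refl
  ∼⇒Joinable {x = x} (bwd (step z v e refl)) =
    x , done ≗-refl , ⟶⇒⟶* (fire z v (e , refl) ≗-refl ≗-refl)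
  ∼⇒Joinable (tr x∼y y∼z) with ∼⇒Joinable x∼y | ∼⇒Joinable y∼z
  ... | _ , x↠ , y↠ | _ , y↠′ , z↠ with ⟶*-confluent y↠ y↠′
  ...   | w , a , b = w , x↠ ◅◅ a , z↠ ◅◅ b

module Tally (G : Graph) where
  open WalkOrder G using (V)
  open Reduction G using (_⊕_; δ-diag; ≗-sym)

  tally : ∀ {X : Set} → (X → V) → List X → Elt G
  tally τ []      u = 0
  tally τ (x ∷ L) u = δ G (τ x) u + tally τ L u

  module _ {X : Set} (τ : X → V) where

    tally-++ : ∀ L L′ → tally τ (L ++ L′) ≗ tally τ L ⊕ tally τ L′
    tally-++ []      L′ u = refl
    tally-++ (x ∷ L) L′ u =
      trans (cong (δ G (τ x) u +_) (tally-++ L L′ u)) (sym (+-assoc (δ G (τ x) u) _ _))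

    tally≗0 : ∀ L → tally τ L ≗ (λ _ → 0) → L ≡ []
    tally≗0 []      _  = refl
    tally≗0 (x ∷ L) eq with () ← trans (cong (_+ tally τ L (τ x)) (sym (δ-diag (τ x)))) (eq (τ x))

    tally-∷-pos : ∀ x L → 1 ≤ tally τ (x ∷ L) (τ x)
    tally-∷-pos x L = subst (λ n → 1 ≤ n + tally τ L (τ x)) (sym (δ-diag (τ x))) (s≤s z≤n)

    tally-pos : ∀ L {u} → 1 ≤ tally τ L u → ∃[ x ] (x ∈ L × τ x ≡ u)
    tally-pos (x ∷ L) {u} pos with τ x ≟ u
    ... | yes τx≡u = x , here refl , τx≡u
    ... | no _ with y , y∈L , τy≡u ← tally-pos L pos = y , there y∈L , τy≡u

  record Removal {X : Set} (y : X) (L : List X) : Set where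
    field
      rest    : List X
      rest⊆   : ∀ {z} → z ∈ rest → z ∈ L
      ∈-rest  : ∀ {z} → z ∈ L → z ≡ y ⊎ z ∈ rest
      unique  : Unique L → Unique rest × y ∉ rest
      tally≗  : ∀ τ → tally τ L ≗ δ G (τ y) ⊕ tally τ rest

  remove : ∀ {X : Set} {y : X} {L} → y ∈ L → Removal y L
  remove {L = _ ∷ L} (here refl) = record
    { rest   = L
    ; rest⊆  = there
    ; ∈-rest = λ { (here z≡y) → inj₁ z≡y ; (there z∈L) → inj₂ z∈L }
    ; unique = λ { (y∉L ∷ uL) → uL , All¬⇒¬Any y∉L }
    ; tally≗ = λ τ u → refl
    }
  remove {y = y} {L = x ∷ L} (there y∈L) = record
    { rest   = x ∷ R.rest
    ; rest⊆  = λ { (here z≡x) → here z≡x ; (there z∈rest) → there (R.rest⊆ z∈rest) }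
    ; ∈-rest = λ { (here z≡x) → inj₂ (here z≡x) ; (there z∈L) → Sum.map₂ there (R.∈-rest z∈L) }
    ; unique = λ { (x∉L ∷ uL) → let uR , y∉R = R.unique uL in
                   All.tabulate (λ z∈R → All.lookup x∉L (R.rest⊆ z∈R)) ∷ uR
                 , λ { (here y≡x)  → All¬⇒¬Any x∉L (subst (_∈ L) y≡x y∈L)
                     ; (there y∈R) → y∉R y∈R } }
    ; tally≗ = λ τ u → trans (cong (δ G (τ x) u +_) (R.tally≗ τ u))
                             (x∙yz≈y∙xz +-commutativeSemigroup (δ G (τ x) u) (δ G (τ y) u) _)
    }
    where module R = Removal (remove y∈L)

  record Matching {A B : Set} (τA : A → V) (τB : B → V) (LA : List A) (LB : List B) : Set where
    field
      π           : A → B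
      π-∈         : ∀ {p} → p ∈ LA → π p ∈ LB
      π-injective : ∀ {p q} → p ∈ LA → q ∈ LA → π p ≡ π q → p ≡ q
      π-onto      : ∀ {r} → r ∈ LB → ∃[ p ] (p ∈ LA × π p ≡ r)
      π-τ     : ∀ {p} → p ∈ LA → τA p ≡ τB (π p)

  module _ {A B : Set} (_≟ᴬ_ : DecidableEquality A) (τA : A → V) (τB : B → V) where

    Matching-∷ : ∀ {x y LA LB} (y∈LB : y ∈ LB) → Unique LB → x ∉ LA → τA x ≡ τB y →
                 Matching τA τB LA (Removal.rest (remove y∈LB)) → Matching τA τB (x ∷ LA) LB
    Matching-∷ {x} {y} {LA} y∈LB uB x∉LA τx≡τy M = record
      { π = π ; π-∈ = π-∈ ; π-injective = π-injective ; π-onto = π-onto ; π-τ = π-τ }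
      where
      module R = Removal (remove y∈LB)
      module M = Matching M
      y∉rest : y ∉ R.rest
      y∉rest = proj₂ (R.unique uB)
      π : A → B
      π p with p ≟ᴬ x
      ... | yes _ = y
      ... | no _  = M.π p
      tail∈ : ∀ {p} → p ∈ x ∷ LA → p ≢ x → p ∈ LA
      tail∈ (here p≡x)   p≢x = ⊥-elim (p≢x p≡x)
      tail∈ (there p∈LA) _   = p∈LA
      π-∈ : ∀ {p} → p ∈ x ∷ LA → π p ∈ _
      π-∈ {p} p∈ with p ≟ᴬ x
      ... | yes _  = y∈LB
      ... | no p≢x = R.rest⊆ (M.π-∈ (tail∈ p∈ p≢x))
      π-injective : ∀ {p q} → p ∈ x ∷ LA → q ∈ x ∷ LA → π p ≡ π q → p ≡ q
      π-injective {p} {q} p∈ q∈ πp≡πq with p ≟ᴬ x | q ≟ᴬ x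
      ... | yes p≡x | yes q≡x = trans p≡x (sym q≡x)
      ... | yes _   | no q≢x  = ⊥-elim (y∉rest (subst (_∈ R.rest) (sym πp≡πq) (M.π-∈ (tail∈ q∈ q≢x))))
      ... | no p≢x  | yes _   = ⊥-elim (y∉rest (subst (_∈ R.rest) πp≡πq       (M.π-∈ (tail∈ p∈ p≢x))))
      ... | no p≢x  | no q≢x  = M.π-injective (tail∈ p∈ p≢x) (tail∈ q∈ q≢x) πp≡πq
      π-onto : ∀ {r} → r ∈ _ → ∃[ p ] (p ∈ x ∷ LA × π p ≡ r)
      π-onto r∈ with R.∈-rest r∈
      ... | inj₁ refl = x , here refl , πx≡y
        where
        πx≡y : π x ≡ y
        πx≡y with x ≟ᴬ x
        ... | yes _  = refl
        ... | no x≢x = ⊥-elim (x≢x refl)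
      ... | inj₂ r∈rest with p , p∈LA , πp≡r ← M.π-onto r∈rest = p , there p∈LA , πp≡r′
        where
        πp≡r′ : π p ≡ _
        πp≡r′ with p ≟ᴬ x
        ... | yes refl = ⊥-elim (x∉LA p∈LA)
        ... | no _     = πp≡r
      π-τ : ∀ {p} → p ∈ x ∷ LA → τA p ≡ τB (π p)
      π-τ {p} p∈ with p ≟ᴬ x
      ... | yes refl = τx≡τy
      ... | no p≢x   = M.π-τ (tail∈ p∈ p≢x)

    matching : B → ∀ {LA LB} → Unique LA → Unique LB → tally τA LA ≗ tally τB LB →
               Matching τA τB LA LB
    matching b {[]} {LB} _ _ eq with refl ← tally≗0 τB LB (≗-sym eq) = record
      { π = λ _ → b ; π-∈ = λ () ; π-injective = λ () ; π-onto = λ () ; π-τ = λ () }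
    matching b {x ∷ LA} {LB} (x∉LA ∷ uA) uB eq =
      Matching-∷ y∈LB uB (All¬⇒¬Any x∉LA) (sym τy≡τx) (matching b uA (proj₁ (R.unique uB)) eq′)
      where
      found : ∃[ y ] (y ∈ LB × τB y ≡ τA x)
      found = tally-pos τB LB (subst (1 ≤_) (eq (τA x)) (tally-∷-pos τA x LA))
      y∈LB = proj₁ (proj₂ found)
      τy≡τx = proj₂ (proj₂ found)
      module R = Removal (remove y∈LB)
      eq′ : tally τA LA ≗ tally τB R.rest
      eq′ u = +-cancelˡ-≡ (δ G (τA x) u) _ _ (begin
        δ G (τA x) u + tally τA LA u             ≡⟨ eq u ⟩
        tally τB LB u                            ≡⟨ R.tally≗ τB u ⟩
        δ G (τB _) u + tally τB R.rest u          ≡⟨ cong (λ v → δ G v u + tally τB R.rest u) τy≡τx ⟩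
        δ G (τA x) u + tally τB R.rest u         ∎)
        where open ≡-Reasoning

module Cuts (G : Graph) (S : Fin (nV G)) where
  open WalkOrder G
  open Reduction G
  open Tally G

  Above : List (Walks G S) → Walks G S → Set
  Above L w = ∃[ x ] (x ∈ L × x ≼ w)

  module _ (L : List (Walks G S)) where

    Above-isSubspace : IsSubspace G (Above L)
    Above-isSubspace _ _ (x , x∈L , x≼w) w≼w′ = x , x∈L , ≼-trans x≼w w≼w′

    Above-isCofinite : IsCofinite G (Above L)
    Above-isCofinite = L , λ _ → mk⇔ id id

    InBasis-Above⇒∈ : ∀ {p} → InBasis G (Above L) p → p ∈ L
    InBasis-Above⇒∈ ((x , x∈L , x≼p) , minimal) = subst (_∈ L) (minimal x (x , x∈L , ≼-refl x) x≼p) x∈L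

  record Cut (z : Elt G) : Set where
    field
      basis     : List (Walks G S)
      unique    : Unique basis
      antichain : ∀ {p q} → p ∈ basis → q ∈ basis → p ≼ q → p ≡ q
      complete  : ∀ w → ∃[ x ] (x ∈ basis × (w ≼ x ⊎ x ≼ w))
      termini   : tally (T G) basis ≗ z

    Above-isInescapable : IsInescapable G (Above basis)
    Above-isInescapable w with complete w
    ... | x , x∈ , inj₁ w≼x = x , w≼x , x , x∈ , ≼-refl x
    ... | x , x∈ , inj₂ x≼w = w , ≼-refl w , x , x∈ , x≼w

    ∈⇒InBasis-Above : ∀ {p} → p ∈ basis → InBasis G (Above basis) p
    ∈⇒InBasis-Above {p} p∈ = (p , p∈ , ≼-refl p) , minimal
      where
      minimal : ∀ w → Above basis w → w ≼ p → w ≡ p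
      minimal w (x , x∈ , x≼w) w≼p with refl ← antichain x∈ p∈ (≼-trans x≼w w≼p) = ≼-antisym w≼p x≼w

  outEdgesIn : (v : V) → List E → List (Out v)
  outEdgesIn v []       = []
  outEdgesIn v (e ∷ es) with o G e ≟ v
  ... | yes o≡v = (e , o≡v) ∷ outEdgesIn v es
  ... | no _    = outEdgesIn v es

  ∈-outEdgesIn⁺ : ∀ {v es} (e : Out v) → proj₁ e ∈ es → e ∈ outEdgesIn v es
  ∈-outEdgesIn⁺ {v} {e ∷ _} (e , o≡v) (here refl) with o G e ≟ v
  ... | yes o≡v′ = here (Out-≡ refl)
  ... | no o≢v   = ⊥-elim (o≢v o≡v)
  ∈-outEdgesIn⁺ {v} {e′ ∷ _} e (there e∈es) with o G e′ ≟ v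
  ... | yes _ = there (∈-outEdgesIn⁺ e e∈es)
  ... | no _  = ∈-outEdgesIn⁺ e e∈es

  ∈-outEdgesIn⁻ : ∀ {v es} {e : Out v} → e ∈ outEdgesIn v es → proj₁ e ∈ es
  ∈-outEdgesIn⁻ {v} {e′ ∷ es} e∈ with o G e′ ≟ v | e∈
  ... | yes _ | here refl = here refl
  ... | yes _ | there e∈′ = there (∈-outEdgesIn⁻ e∈′)
  ... | no _  | e∈′       = there (∈-outEdgesIn⁻ e∈′)

  outEdgesIn-unique : ∀ {v es} → Unique es → Unique (outEdgesIn v es)
  outEdgesIn-unique {v} {[]}     _            = []
  outEdgesIn-unique {v} {e ∷ es} (e∉es ∷ ues) with o G e ≟ v
  ... | yes _ = All.tabulate (λ e′∈ e≡e′ → All¬⇒¬Any e∉es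
                  (subst (_∈ es) (sym (cong proj₁ e≡e′)) (∈-outEdgesIn⁻ e′∈)))
              ∷ outEdgesIn-unique ues
  ... | no _  = outEdgesIn-unique ues

  tally-outEdgesIn : ∀ (p : Walks G S) es → tally (T G) (map (p ▹_) (outEdgesIn (T G p) es)) ≗
                     λ u → sum (map (λ e → δ G (T G p) (o G e) * δ G (t G e) u) es)
  tally-outEdgesIn p []       u = refl
  tally-outEdgesIn p (e ∷ es) u with o G e ≟ T G p
  ... | yes o≡v = cong₂ _+_ (sym (trans (cong (_* δ G (t G e) u) coefficient) (*-identityˡ _)))
                            (tally-outEdgesIn p es u)
    where
    coefficient : δ G (T G p) (o G e) ≡ 1
    coefficient = trans (cong (δ G (T G p)) o≡v) (δ-diag _)
  ... | no o≢v  = trans (tally-outEdgesIn p es u)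
                        (cong (λ k → k * δ G (t G e) u + _) (sym (δ-off (o≢v ∘ sym))))

  children : Walks G S → List (Walks G S)
  children p = map (p ▹_) (outEdgesIn (T G p) (allFin (nE G)))

  ∈-children⁺ : ∀ p e → p ▹ e ∈ children p
  ∈-children⁺ p e = ∈-map⁺ (p ▹_) (∈-outEdgesIn⁺ e (∈-allFin (proj₁ e)))

  ∈-children⁻ : ∀ {p q} → q ∈ children p → ∃[ e ] (q ≡ p ▹ e)
  ∈-children⁻ q∈ with e , _ , q≡ ← ∈-map⁻ _ q∈ = e , q≡

  children-unique : ∀ p → Unique (children p)
  children-unique p = Unique.map⁺ (▹-injective p) (outEdgesIn-unique (Unique.allFin⁺ (nE G)))

  tally-children : ∀ p → tally (T G) (children p) ≗ succs G (T G p)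
  tally-children p = tally-outEdgesIn p (allFin (nE G))

  -- p is replaced by its children; e₀ guarantees there is one, which keeps the antichain maximal.
  module Expansion {z} (c : Cut z) {p} (p∈ : p ∈ Cut.basis c) (e₀ : Out (T G p)) where
    open Cut c
    module R = Removal (remove p∈)

    basis′ : List (Walks G S)
    basis′ = children p ++ R.rest

    p∉rest : p ∉ R.rest
    p∉rest = proj₂ (R.unique unique)

    child∉basis : ∀ e → p ▹ e ∉ basis
    child∉basis e child∈ = ▹-≢ p e (sym (antichain p∈ child∈ (≼-▹ p e)))

    unique′ : Unique basis′
    unique′ = Unique.++⁺ (children-unique p) (proj₁ (R.unique unique)) disjoint
      where
      disjoint : ∀ {q} → ¬ (q ∈ children p × q ∈ R.rest)
      disjoint (q∈ , q∈rest) with e , refl ← ∈-children⁻ q∈ = child∉basis e (R.rest⊆ q∈rest)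

    antichain′ : ∀ {q q′} → q ∈ basis′ → q′ ∈ basis′ → q ≼ q′ → q ≡ q′
    antichain′ q∈ q′∈ q≼q′ with ∈-++⁻ (children p) q∈ | ∈-++⁻ (children p) q′∈
    ... | inj₁ q∈ch | inj₁ q′∈ch
      with e , refl ← ∈-children⁻ q∈ch | e′ , refl ← ∈-children⁻ q′∈ch = ▹-≼-▹ p q≼q′
    ... | inj₁ q∈ch | inj₂ q′∈rest with e , refl ← ∈-children⁻ q∈ch
      with refl ← antichain p∈ (R.rest⊆ q′∈rest) (≼-trans (≼-▹ p e) q≼q′) = ⊥-elim (p∉rest q′∈rest)
    ... | inj₂ q∈rest | inj₁ q′∈ch with e , refl ← ∈-children⁻ q′∈ch with ≼-▹⁻ p e q≼q′
    ...   | inj₁ q≼p with refl ← antichain (R.rest⊆ q∈rest) p∈ q≼p = ⊥-elim (p∉rest q∈rest)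
    ...   | inj₂ q≡ = q≡
    antichain′ _ _ q≼q′ | inj₂ q∈rest | inj₂ q′∈rest = antichain (R.rest⊆ q∈rest) (R.rest⊆ q′∈rest) q≼q′

    complete′ : ∀ w → ∃[ x ] (x ∈ basis′ × (w ≼ x ⊎ x ≼ w))
    complete′ w with complete w
    ... | x , x∈ , cmp with R.∈-rest x∈
    ...   | inj₂ x∈rest = x , ∈-++⁺ʳ (children p) x∈rest , cmp
    ...   | inj₁ refl with cmp
    ...     | inj₁ w≼p = p ▹ e₀ , ∈-++⁺ˡ (∈-children⁺ p e₀) , inj₁ (≼-trans w≼p (≼-▹ p e₀))
    ...     | inj₂ p≼w with ▹⁻-≼ p w p≼w
    ...       | inj₁ refl = p ▹ e₀ , ∈-++⁺ˡ (∈-children⁺ p e₀) , inj₁ (≼-▹ p e₀)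
    ...       | inj₂ (e , p▹e≼w) = p ▹ e , ∈-++⁺ˡ (∈-children⁺ p e) , inj₂ p▹e≼w

    termini′ : tally (T G) basis′ ≗ succs G (T G p) ⊕ tally (T G) R.rest
    termini′ u = trans (tally-++ (T G) (children p) R.rest u)
                       (cong (_+ tally (T G) R.rest u) (tally-children p u))

  Cut-resp-≗ : ∀ {x y} → x ≗ y → Cut x → Cut y
  Cut-resp-≗ x≗y c = record { Cut c hiding (termini) ; termini = ≗-trans (Cut.termini c) x≗y }

  root-cut : Cut (δ G S)
  root-cut = record
    { basis     = [ (S , ε S) ]
    ; unique    = All.[] ∷ []
    ; antichain = λ { (here refl) (here refl) _ → refl }
    ; complete  = λ w → (S , ε S) , here refl , inj₂ (proj₂ w , refl)
    ; termini   = λ u → +-identityʳ (δ G S u)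
    }

  basis-ending-at : ∀ {x z v} (c : Cut x) → x ≗ z ⊕ δ G v → ∃[ p ] (p ∈ Cut.basis c × T G p ≡ v)
  basis-ending-at {z = z} {v} c x≗ = tally-pos (T G) (Cut.basis c) (begin
    1                           ≤⟨ m≤n+m 1 (z v) ⟩
    z v + 1                     ≡⟨ cong (z v +_) (δ-diag v) ⟨
    z v + δ G v v               ≡⟨ x≗ v ⟨
    _                           ≡⟨ Cut.termini c v ⟨
    tally (T G) (Cut.basis c) v ∎)
    where open ≤-Reasoning

  expand : ∀ {x y} → Cut x → x ⟶ y → Cut y
  expand c (fire z v e₀ x≗ y≗) with (_ , w) , p∈ , refl ← basis-ending-at c x≗ = record
    { basis = E.basis′ ; unique = E.unique′ ; antichain = E.antichain′ ; complete = E.complete′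
    ; termini = termini′ }
    where
    module E = Expansion c p∈ e₀
    open ≗-Reasoning
    rest≗z : tally (T G) E.R.rest ≗ z
    rest≗z = ⊕-cancelʳ (δ G v) (begin
      tally (T G) E.R.rest ⊕ δ G v  ≈⟨ ⊕-comm _ (δ G v) ⟩
      δ G v ⊕ tally (T G) E.R.rest  ≈⟨ E.R.tally≗ (T G) ⟨
      tally (T G) (Cut.basis c)     ≈⟨ Cut.termini c ⟩
      _                             ≈⟨ x≗ ⟩
      z ⊕ δ G v                     ∎)
    termini′ : tally (T G) E.basis′ ≗ _
    termini′ = begin
      tally (T G) E.basis′                ≈⟨ E.termini′ ⟩
      succs G v ⊕ tally (T G) E.R.rest    ≈⟨ ⊕-congˡ (succs G v) rest≗z ⟩
      succs G v ⊕ z                       ≈⟨ ⊕-comm (succs G v) z ⟩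
      z ⊕ succs G v                       ≈⟨ y≗ ⟨
      _                                   ∎

  reduction-cut : ∀ {x y} → Cut x → x ⟶* y → Cut y
  reduction-cut c (done x≗y)  = Cut-resp-≗ x≗y c
  reduction-cut c (s ◅ ss) = reduction-cut (expand c s) ss

  Above-isCofiniteInescapableSubspace : ∀ {z} (c : Cut z) → let P = Above (Cut.basis c) in
    IsSubspace G P × IsCofinite G P × IsInescapable G P
  Above-isCofiniteInescapableSubspace c =
    Above-isSubspace (Cut.basis c) , Above-isCofinite (Cut.basis c) , Cut.Above-isInescapable c

lemma14 : (G : Graph) (S R : Fin (nV G)) →
    IsRoot G S → IsRoot G R → EqInMonoid G S R →
    ∃[ PS ] ∃[ PR ]
      ( (IsSubspace G PS × IsCofinite G PS × IsInescapable G PS)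
      × (IsSubspace G PR × IsCofinite G PR × IsInescapable G PR)
      × Σ (Walks G S → Walks G R) λ π →
          (∀ p → InBasis G PS p → InBasis G PR (π p))
        × (∀ p q → InBasis G PS p → InBasis G PS q → π p ≡ π q → p ≡ q)
        × (∀ r → InBasis G PR r → ∃[ p ] (InBasis G PS p × π p ≡ r))
        × (∀ p → InBasis G PS p → T G p ≡ T G (π p)) )
lemma14 G S R _ _ S≈R =
  CS.Above BS , CR.Above BR ,
  CS.Above-isCofiniteInescapableSubspace cS , CR.Above-isCofiniteInescapableSubspace cR ,
  M.π ,
  (λ p p∈ → CR.Cut.∈⇒InBasis-Above cR (M.π-∈ (inS p∈))) ,
  (λ p q p∈ q∈ → M.π-injective (inS p∈) (inS q∈)) ,
  (λ r r∈ → let p , p∈ , πp≡r = M.π-onto (inR r∈) in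
            p , CS.Cut.∈⇒InBasis-Above cS p∈ , πp≡r) ,
  (λ p p∈ → M.π-τ (inS p∈))
  where
  module CS = Cuts G S
  module CR = Cuts G R
  common = Reduction.∼⇒Joinable G S≈R
  cS = CS.reduction-cut CS.root-cut (proj₁ (proj₂ common))
  cR = CR.reduction-cut CR.root-cut (proj₂ (proj₂ common))
  BS = CS.Cut.basis cS
  BR = CR.Cut.basis cR
  inS = CS.InBasis-Above⇒∈ BS
  inR = CR.InBasis-Above⇒∈ BR
  module M = Tally.Matching (Tally.matching G (WalkOrder._≟ʷ_ G) (T G) (T G) (R , ε R)
    (CS.Cut.unique cS) (CR.Cut.unique cR)
    (λ u → trans (CS.Cut.termini cS u) (sym (CR.Cut.termini cR u))))
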